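{- Let $S=\ \Rightarrow A_1,\dots,A_m,\langle G_1\rangle,\dots,\langle G_n\rangle,[H_1],\dots,[H_l]$ be a sequent provable in $\mathbf{C}_{\mathbf{LIKD}^- }$ (resp. $\mathbf{C}_{\mathbf{LIKT}^- }$), where the $A_i$ are formulas and the $G_j,H_k$ are sequents, such that each $H_k$ is of the form $\Rightarrow\Theta_k$ and every sequent $T$ with $T\in^{[\cdot]}H_k$ has empty antecedent. Then for some $i\leq m$, $j\leq n$ or $k\leq l$, one of $\Rightarrow A_i$, $\Rightarrow\langle G_j\rangle$, $\Rightarrow[H_k]$ is provable in $\mathbf{C}_{\mathbf{LIKD}^- }$ (resp. $\mathbf{C}_{\mathbf{LIKT}^- }$).
   Context: Formulas: $A::=p\mid A\supset A\mid \top\mid\bot\mid A\vee A\mid A\wedge A\mid \square A\mid \lozenge A$. Bi-nested sequents: the empty sequent $\Rightarrow$ is a sequent; $\Gamma\Rightarrow B_1,\dots,B_k,[S_1],\dots,[S_m],\langle T_1\rangle,\dots,\langle T_n\rangle$ is a sequent, where $\Gamma$ is a finite multiset of formulas, $B_i$ formulas, $S_i,T_j$ sequents ($[S]$: modal block, $\langle T\rangle$: implication block). $T\in^{[\cdot]}_0U$ means $[T]$ occurs directly in the succedent of $U$; $\in^{[\cdot]}$ is the transitive closure of $\in^{[\cdot]}_0$. Contexts: $\{\}$ is a context; if $\Gamma\Rightarrow\Delta$ is a sequent and $G'\{\}$ a context then $\Gamma\Rightarrow\Delta,\langle G'\{\}\rangle$ and $\Gamma\Rightarrow\Delta,[G'\{\}]$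 are contexts; $G\{S\}$ fills the hole with $S$. For a succedent $\Theta=\Theta_0,[\Phi_1\Rightarrow\Psi_1],\dots,[\Phi_k\Rightarrow\Psi_k]$ with $\Theta_0$ containing no modal blocks at top level, $\Theta^\flat=[\Phi_1\Rightarrow\Psi_1^\flat],\dots,[\Phi_k\Rightarrow\Psi_k^\flat]$ (empty if $k=0$). Rules of $\mathbf{C}_{\mathbf{LIK}^- }$ (premises / conclusion, $G$ any context): axioms $G\{\Gamma,\bot\Rightarrow\Delta\}$, $G\{\Gamma\Rightarrow\top,\Delta\}$, $G\{\Gamma,p\Rightarrow\Delta,p\}$ ($p$ atom); $(\wedge_L)$ $G\{A,B,\Gamma\Rightarrow\Delta\}$ / $G\{A\wedge B,\Gamma\Rightarrow\Delta\}$; $(\wedge_R)$ $G\{\Gamma\Rightarrow\Delta,A\}$, $G\{\Gamma\Rightarrow\Delta,B\}$ / $G\{\Gamma\Rightarrow\Delta,A\wedge B\}$; $(\vee_L)$ $G\{\Gamma,A\Rightarrow\Delta\}$, $G\{\Gamma,B\Rightarrow\Delta\}$ / $G\{\Gamma,A\vee B\Rightarrow\Delta\}$; $(\vee_R)$ $G\{\Gamma\Rightarrow\Delta,A,B\}$ / $G\{\Gamma\Rightarrow\Delta,A\vee B\}$; $(\supset_L)$ $G\{\Gamma,A\supset B\Rightarrow A,\Delta\}$, $G\{\Gamma,B\Rightarrow\Delta\}$ / $G\{\Gamma,A\supset B\Rightarrow\Delta\}$; $(\supset_R)$ $G\{\Gamma\Rightarrow\Delta,\langle A\Rightarrow B\rangle\}$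 / $G\{\Gamma\Rightarrow\Delta,A\supset B\}$; $(\square_L)$ $G\{\Gamma,\square A\Rightarrow\Delta,[\Sigma,A\Rightarrow\Pi]\}$ / $G\{\Gamma,\square A\Rightarrow\Delta,[\Sigma\Rightarrow\Pi]\}$; $(\square_R)$ $G\{\Gamma\Rightarrow\Delta,[\Rightarrow A]\}$ / $G\{\Gamma\Rightarrow\Delta,\square A\}$; $(\lozenge_L)$ $G\{\Gamma\Rightarrow\Delta,[A\Rightarrow]\}$ / $G\{\Gamma,\lozenge A\Rightarrow\Delta\}$; $(\lozenge_R)$ $G\{\Gamma\Rightarrow\Delta,\lozenge A,[\Sigma\Rightarrow\Pi,A]\}$ / $G\{\Gamma\Rightarrow\Delta,\lozenge A,[\Sigma\Rightarrow\Pi]\}$; (trans) $G\{\Gamma,\Gamma'\Rightarrow\Delta,\langle\Gamma',\Sigma\Rightarrow\Pi\rangle\}$ / $G\{\Gamma,\Gamma'\Rightarrow\Delta,\langle\Sigma\Rightarrow\Pi\rangle\}$; $(\mathrm{inter}_\rightarrow)$ $G\{\Gamma\Rightarrow\Delta,\langle\Sigma\Rightarrow\Pi,[\Lambda\Rightarrow\Theta^\flat]\rangle,[\Lambda\Rightarrow\Theta]\}$ / $G\{\Gamma\Rightarrow\Delta,\langle\Sigma\Rightarrow\Pi\rangle,[\Lambda\Rightarrow\Theta]\}$. $\mathbf{C}_{\mathbf{LIKD}^- }$ adds $(\mathbf{D})$: $G\{\Gamma\Rightarrow\Delta,[\Rightarrow]\}$ / $G\{\Gamma\Rightarrow\Delta\}$.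 $\mathbf{C}_{\mathbf{LIKT}^- }$ adds $(\mathbf{T}_\square)$: $G\{\Gamma,\square A,A\Rightarrow\Delta\}$ / $G\{\Gamma,\square A\Rightarrow\Delta\}$ and $(\mathbf{T}_\lozenge)$: $G\{\Gamma\Rightarrow\Delta,\lozenge A,A\}$ / $G\{\Gamma\Rightarrow\Delta,\lozenge A\}$. A sequent is provable if it is the root of a finite tree of rule instances whose leaves are axioms. -}

module Defs where

open import Data.Nat using (ℕ)
open import Data.List using (List; []; _∷_; _++_; map)
open import Data.List.Relation.Binary.Permutation.Propositional using (_↭_)
open import Data.List.Membership.Propositional using (_∈_)
open import Relation.Binary.Construct.Closure.Transitive using (TransClosure)
open import Relation.Binary.PropositionalEquality using (_≡_)

infixr 6 _∧_
infixr 5 _∨_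
infixr 4 _⊃_
infix 3 _⇒_

data Fm : Set where
  atom : ℕ → Fm
  _⊃_  : Fm → Fm → Fm
  ⊤F   : Fm
  ⊥F   : Fm
  _∨_  : Fm → Fm → Fm
  _∧_  : Fm → Fm → Fm
  □    : Fm → Fm
  ◇    : Fm → Fm

-- Multisets are
-- represented by lists; the calculus below contains an exchange rule (applicable
-- at any depth, inside any context) so that provability is invariant under
-- reordering, i.e. sequents are effectively taken up to multiset equality.
data Item : Set
data Seq : Set

data Item where
  fm  : Fm → Item
  box : Seq → Item    -- modal block  [S]
  imp : Seq → Item    -- implication block ⟨S⟩

data Seq where
  _⇒_ : List Fm → List Item → Seq

ante : Seq → List Fm
ante (Γ ⇒ Δ) = Γ

data _∈⁰_ : Seq → Seq → Set where
  direct : ∀ {T Γ Δ} → box T ∈ Δ → T ∈⁰ (Γ ⇒ Δ)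

_∈[·]_ : Seq → Seq → Set
_∈[·]_ = TransClosure _∈⁰_

flat : List Item → List Item
flat []                   = []
flat (fm _ ∷ Θ)           = flat Θ
flat (imp _ ∷ Θ)          = flat Θ
flat (box (Φ ⇒ Ψ) ∷ Θ)    = box (Φ ⇒ flat Ψ) ∷ flat Θ

data Ctx : Set where
  hole : Ctx
  impC : List Fm → List Item → Ctx → Ctx
  boxC : List Fm → List Item → Ctx → Ctx

plug : Ctx → Seq → Seq
plug hole         S = S
plug (impC Γ Δ G) S = Γ ⇒ (Δ ++ (imp (plug G S) ∷ []))
plug (boxC Γ Δ G) S = Γ ⇒ (Δ ++ (box (plug G S) ∷ []))

data Ext : Set where
  LIKD LIKT : Ext

data Prov (e : Ext) : Seq → Set where
  exch  : ∀ {G Γ Γ' Δ Δ'} → Γ ↭ Γ' → Δ ↭ Δ' →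
          Prov e (plug G (Γ ⇒ Δ)) → Prov e (plug G (Γ' ⇒ Δ'))
  ax⊥   : ∀ {G Γ Δ} → Prov e (plug G ((⊥F ∷ Γ) ⇒ Δ))
  ax⊤   : ∀ {G Γ Δ} → Prov e (plug G (Γ ⇒ (fm ⊤F ∷ Δ)))
  axAt  : ∀ {G Γ Δ p} → Prov e (plug G ((atom p ∷ Γ) ⇒ (fm (atom p) ∷ Δ)))
  ∧L    : ∀ {G Γ Δ A B} → Prov e (plug G ((A ∷ B ∷ Γ) ⇒ Δ)) →
          Prov e (plug G (((A ∧ B) ∷ Γ) ⇒ Δ))
  ∧R    : ∀ {G Γ Δ A B} → Prov e (plug G (Γ ⇒ (fm A ∷ Δ))) →
          Prov e (plug G (Γ ⇒ (fm B ∷ Δ))) →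
          Prov e (plug G (Γ ⇒ (fm (A ∧ B) ∷ Δ)))
  ∨L    : ∀ {G Γ Δ A B} → Prov e (plug G ((A ∷ Γ) ⇒ Δ)) →
          Prov e (plug G ((B ∷ Γ) ⇒ Δ)) →
          Prov e (plug G (((A ∨ B) ∷ Γ) ⇒ Δ))
  ∨R    : ∀ {G Γ Δ A B} → Prov e (plug G (Γ ⇒ (fm A ∷ fm B ∷ Δ))) →
          Prov e (plug G (Γ ⇒ (fm (A ∨ B) ∷ Δ)))
  ⊃L    : ∀ {G Γ Δ A B} → Prov e (plug G (((A ⊃ B) ∷ Γ) ⇒ (fm A ∷ Δ))) →
          Prov e (plug G ((B ∷ Γ) ⇒ Δ)) →
          Prov e (plug G (((A ⊃ B) ∷ Γ) ⇒ Δ))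
  ⊃R    : ∀ {G Γ Δ A B} → Prov e (plug G (Γ ⇒ (imp ((A ∷ []) ⇒ (fm B ∷ [])) ∷ Δ))) →
          Prov e (plug G (Γ ⇒ (fm (A ⊃ B) ∷ Δ)))
  □L    : ∀ {G Γ Δ Σ Π A} → Prov e (plug G ((□ A ∷ Γ) ⇒ (box ((A ∷ Σ) ⇒ Π) ∷ Δ))) →
          Prov e (plug G ((□ A ∷ Γ) ⇒ (box (Σ ⇒ Π) ∷ Δ)))
  □R    : ∀ {G Γ Δ A} → Prov e (plug G (Γ ⇒ (box ([] ⇒ (fm A ∷ [])) ∷ Δ))) →
          Prov e (plug G (Γ ⇒ (fm (□ A) ∷ Δ)))
  ◇L    : ∀ {G Γ Δ A} → Prov e (plug G (Γ ⇒ (box ((A ∷ []) ⇒ []) ∷ Δ))) →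
          Prov e (plug G ((◇ A ∷ Γ) ⇒ Δ))
  ◇R    : ∀ {G Γ Δ Σ Π A} → Prov e (plug G (Γ ⇒ (fm (◇ A) ∷ box (Σ ⇒ (fm A ∷ Π)) ∷ Δ))) →
          Prov e (plug G (Γ ⇒ (fm (◇ A) ∷ box (Σ ⇒ Π) ∷ Δ)))
  trans : ∀ {G Γ Γ' Δ Σ Π} → Prov e (plug G ((Γ ++ Γ') ⇒ (imp ((Γ' ++ Σ) ⇒ Π) ∷ Δ))) →
          Prov e (plug G ((Γ ++ Γ') ⇒ (imp (Σ ⇒ Π) ∷ Δ)))
  inter : ∀ {G Γ Δ Σ Π Λ Θ} →
          Prov e (plug G (Γ ⇒ (imp (Σ ⇒ (Π ++ (box (Λ ⇒ flat Θ) ∷ []))) ∷ box (Λ ⇒ Θ) ∷ Δ))) →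
          Prov e (plug G (Γ ⇒ (imp (Σ ⇒ Π) ∷ box (Λ ⇒ Θ) ∷ Δ)))
  D     : ∀ {G Γ Δ} → e ≡ LIKD → Prov e (plug G (Γ ⇒ (box ([] ⇒ []) ∷ Δ))) →
          Prov e (plug G (Γ ⇒ Δ))
  T□    : ∀ {G Γ Δ A} → e ≡ LIKT → Prov e (plug G ((□ A ∷ A ∷ Γ) ⇒ Δ)) →
          Prov e (plug G ((□ A ∷ Γ) ⇒ Δ))
  T◇    : ∀ {G Γ Δ A} → e ≡ LIKT → Prov e (plug G (Γ ⇒ (fm (◇ A) ∷ fm A ∷ Δ))) →
          Prov e (plug G (Γ ⇒ (fm (◇ A) ∷ Δ)))

-- Call the formulas and implication blocks in the succedent of a sequent, or in
-- its nested modal blocks, its leaves.  If every modal block (and the sequent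
-- itself) has empty antecedent, then some leaf L is provable on its own, ⇒ L;
-- by induction on the derivation: left rules cannot apply at such a sequent, a
-- rule inside an implication block concerns a single leaf, and right rules pass
-- provability of a leaf down (◇R via D, resp. T◇).  The delicate rule is inter,
-- which adds a formula-free block [⇒ Θ^♭] to an implication block.  Such a block
-- can be removed again: in D by repeated (D), in T because dissolving modal
-- blocks into the enclosing sequent is admissible, by T□ and T◇.  A provable
-- leaf inside [H_k] finally gives ⇒ [H_k].

module Submission where

open import Defs
open import Data.List using (List; []; _∷_; _++_; map)
open import Data.List.Properties using (++-assoc; ++-identityʳ; ++-conicalʳ)
open import Data.List.Relation.Unary.All as All using (All; []; _∷_)
import Data.List.Relation.Unary.All.Properties as Allₚ
open import Data.List.Relation.Unary.Any as Any using (Any; here; there)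
import Data.List.Relation.Unary.Any.Properties as Anyₚ
open import Data.List.Relation.Binary.Permutation.Propositional
  using (_↭_; ↭-refl; ↭-sym; ↭-trans; ↭-reflexive; prep; swap)
import Data.List.Relation.Binary.Permutation.Propositional as ↭
open import Data.List.Relation.Binary.Permutation.Propositional.Properties
  using (++⁺; ++⁺ˡ; ++⁺ʳ; ++-comm; shift; shifts; ∷↭∷ʳ; ↭-empty-inv; Any-resp-↭; All-resp-↭; ++-commutativeMonoid)
open import Data.Product using (_×_; _,_)
open import Data.Sum using (_⊎_; inj₁; inj₂)
open import Data.Unit using (⊤; tt)
open import Function using (_∘_)
open import Relation.Binary.Construct.Closure.Transitive using ([_]; _∷_; _∷ʳ_)
open import Relation.Binary.PropositionalEquality
  using (_≡_; refl; sym; cong; subst; subst₂; module ≡-Reasoning)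
import Algebra.Solver.CommutativeMonoid as CommutativeMonoidSolver

private
  module FmSolver = CommutativeMonoidSolver (++-commutativeMonoid {A = Fm})

regroup : ∀ {A : Set} (o s a x : List A) → o ++ (s ++ (a ++ (x ++ []))) ≡ (o ++ (s ++ a)) ++ x
regroup o s a x = begin
  o ++ (s ++ (a ++ (x ++ [])))  ≡⟨ cong (λ y → o ++ (s ++ (a ++ y))) (++-identityʳ x) ⟩
  o ++ (s ++ (a ++ x))          ≡⟨ cong (o ++_) (++-assoc s a x) ⟨
  o ++ ((s ++ a) ++ x)          ≡⟨ ++-assoc o (s ++ a) x ⟨
  (o ++ (s ++ a)) ++ x          ∎
  where open ≡-Reasoning

rotate : ∀ {A : Set} (x y z : List A) → x ++ (y ++ z) ↭ z ++ (x ++ y)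
rotate x y z = ↭-trans (↭-reflexive (sym (++-assoc x y z))) (++-comm (x ++ y) z)

middleToEnd : ∀ {A : Set} (x y z : List A) → (x ++ y) ++ z ↭ (x ++ z) ++ y
middleToEnd x y z = begin
  (x ++ y) ++ z  ≡⟨ ++-assoc x y z ⟩
  x ++ (y ++ z)  ↭⟨ ++⁺ˡ x (++-comm y z) ⟩
  x ++ (z ++ y)  ≡⟨ ++-assoc x z y ⟨
  (x ++ z) ++ y  ∎
  where open ↭.PermutationReasoning

data Axiom (e : Ext) : Seq → Set where
  ax⊥  : ∀ {Γ Δ} → Axiom e ((⊥F ∷ Γ) ⇒ Δ)
  ax⊤  : ∀ {Γ Δ} → Axiom e (Γ ⇒ (fm ⊤F ∷ Δ))
  axAt : ∀ {Γ Δ p} → Axiom e ((atom p ∷ Γ) ⇒ (fm (atom p) ∷ Δ))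

data Rule₁ (e : Ext) : Seq → Seq → Set where
  exch  : ∀ {Γ Γ' Δ Δ'} → Γ ↭ Γ' → Δ ↭ Δ' → Rule₁ e (Γ ⇒ Δ) (Γ' ⇒ Δ')
  ∧L    : ∀ {Γ Δ A B} → Rule₁ e ((A ∷ B ∷ Γ) ⇒ Δ) (((A ∧ B) ∷ Γ) ⇒ Δ)
  ∨R    : ∀ {Γ Δ A B} → Rule₁ e (Γ ⇒ (fm A ∷ fm B ∷ Δ)) (Γ ⇒ (fm (A ∨ B) ∷ Δ))
  ⊃R    : ∀ {Γ Δ A B} → Rule₁ e (Γ ⇒ (imp ((A ∷ []) ⇒ (fm B ∷ [])) ∷ Δ)) (Γ ⇒ (fm (A ⊃ B) ∷ Δ))
  □L    : ∀ {Γ Δ Σ Π A} → Rule₁ e ((□ A ∷ Γ) ⇒ (box ((A ∷ Σ) ⇒ Π) ∷ Δ)) ((□ A ∷ Γ) ⇒ (box (Σ ⇒ Π) ∷ Δ))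
  □R    : ∀ {Γ Δ A} → Rule₁ e (Γ ⇒ (box ([] ⇒ (fm A ∷ [])) ∷ Δ)) (Γ ⇒ (fm (□ A) ∷ Δ))
  ◇L    : ∀ {Γ Δ A} → Rule₁ e (Γ ⇒ (box ((A ∷ []) ⇒ []) ∷ Δ)) ((◇ A ∷ Γ) ⇒ Δ)
  ◇R    : ∀ {Γ Δ Σ Π A} → Rule₁ e (Γ ⇒ (fm (◇ A) ∷ box (Σ ⇒ (fm A ∷ Π)) ∷ Δ)) (Γ ⇒ (fm (◇ A) ∷ box (Σ ⇒ Π) ∷ Δ))
  trans : ∀ {Γ Γ' Δ Σ Π} → Rule₁ e ((Γ ++ Γ') ⇒ (imp ((Γ' ++ Σ) ⇒ Π) ∷ Δ)) ((Γ ++ Γ') ⇒ (imp (Σ ⇒ Π) ∷ Δ))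
  inter : ∀ {Γ Δ Σ Π Λ Θ} → Rule₁ e (Γ ⇒ (imp (Σ ⇒ (Π ++ (box (Λ ⇒ flat Θ) ∷ []))) ∷ box (Λ ⇒ Θ) ∷ Δ))
                                    (Γ ⇒ (imp (Σ ⇒ Π) ∷ box (Λ ⇒ Θ) ∷ Δ))
  D     : ∀ {Γ Δ} → e ≡ LIKD → Rule₁ e (Γ ⇒ (box ([] ⇒ []) ∷ Δ)) (Γ ⇒ Δ)
  T□    : ∀ {Γ Δ A} → e ≡ LIKT → Rule₁ e ((□ A ∷ A ∷ Γ) ⇒ Δ) ((□ A ∷ Γ) ⇒ Δ)
  T◇    : ∀ {Γ Δ A} → e ≡ LIKT → Rule₁ e (Γ ⇒ (fm (◇ A) ∷ fm A ∷ Δ)) (Γ ⇒ (fm (◇ A) ∷ Δ))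

data Rule₂ (e : Ext) : Seq → Seq → Seq → Set where
  ∧R : ∀ {Γ Δ A B} → Rule₂ e (Γ ⇒ (fm A ∷ Δ)) (Γ ⇒ (fm B ∷ Δ)) (Γ ⇒ (fm (A ∧ B) ∷ Δ))
  ∨L : ∀ {Γ Δ A B} → Rule₂ e ((A ∷ Γ) ⇒ Δ) ((B ∷ Γ) ⇒ Δ) (((A ∨ B) ∷ Γ) ⇒ Δ)
  ⊃L : ∀ {Γ Δ A B} → Rule₂ e (((A ⊃ B) ∷ Γ) ⇒ (fm A ∷ Δ)) ((B ∷ Γ) ⇒ Δ) (((A ⊃ B) ∷ Γ) ⇒ Δ)

-- Prov with every rule instance split into a context and a local rule,
-- so that arguments about contexts need three cases instead of nineteen.
data Derivation (e : Ext) : Seq → Set where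
  axiom : ∀ {G C} → Axiom e C → Derivation e (plug G C)
  rule₁ : ∀ {G P C} → Rule₁ e P C → Derivation e (plug G P) → Derivation e (plug G C)
  rule₂ : ∀ {G P Q C} → Rule₂ e P Q C → Derivation e (plug G P) → Derivation e (plug G Q) →
          Derivation e (plug G C)

toDerivation : ∀ {e S} → Prov e S → Derivation e S
toDerivation (exch {G} p q d) = rule₁ {G = G} (exch p q) (toDerivation d)
toDerivation (ax⊥ {G})        = axiom {G = G} ax⊥
toDerivation (ax⊤ {G})        = axiom {G = G} ax⊤
toDerivation (axAt {G})       = axiom {G = G} axAt
toDerivation (∧L {G} d)       = rule₁ {G = G} ∧L (toDerivation d)
toDerivation (∧R {G} d d')    = rule₂ {G = G} ∧R (toDerivation d) (toDerivation d')
toDerivation (∨L {G} d d')    = rule₂ {G = G} ∨L (toDerivation d) (toDerivation d')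
toDerivation (∨R {G} d)       = rule₁ {G = G} ∨R (toDerivation d)
toDerivation (⊃L {G} d d')    = rule₂ {G = G} ⊃L (toDerivation d) (toDerivation d')
toDerivation (⊃R {G} d)       = rule₁ {G = G} ⊃R (toDerivation d)
toDerivation (□L {G} d)       = rule₁ {G = G} □L (toDerivation d)
toDerivation (□R {G} d)       = rule₁ {G = G} □R (toDerivation d)
toDerivation (◇L {G} d)       = rule₁ {G = G} ◇L (toDerivation d)
toDerivation (◇R {G} d)       = rule₁ {G = G} ◇R (toDerivation d)
toDerivation (trans {G} d)    = rule₁ {G = G} trans (toDerivation d)
toDerivation (inter {G} d)    = rule₁ {G = G} inter (toDerivation d)
toDerivation (D {G} eq d)     = rule₁ {G = G} (D eq) (toDerivation d)
toDerivation (T□ {G} eq d)    = rule₁ {G = G} (T□ eq) (toDerivation d)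
toDerivation (T◇ {G} eq d)    = rule₁ {G = G} (T◇ eq) (toDerivation d)

fromDerivation : ∀ {e S} → Derivation e S → Prov e S
fromDerivation (axiom {G} ax⊥)             = ax⊥ {G = G}
fromDerivation (axiom {G} ax⊤)             = ax⊤ {G = G}
fromDerivation (axiom {G} axAt)            = axAt {G = G}
fromDerivation (rule₁ {G} (exch p q) d)    = exch {G = G} p q (fromDerivation d)
fromDerivation (rule₁ {G} ∧L d)            = ∧L {G = G} (fromDerivation d)
fromDerivation (rule₁ {G} ∨R d)            = ∨R {G = G} (fromDerivation d)
fromDerivation (rule₁ {G} ⊃R d)            = ⊃R {G = G} (fromDerivation d)
fromDerivation (rule₁ {G} □L d)            = □L {G = G} (fromDerivation d)
fromDerivation (rule₁ {G} □R d)            = □R {G = G} (fromDerivation d)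
fromDerivation (rule₁ {G} ◇L d)            = ◇L {G = G} (fromDerivation d)
fromDerivation (rule₁ {G} ◇R d)            = ◇R {G = G} (fromDerivation d)
fromDerivation (rule₁ {G} trans d)         = trans {G = G} (fromDerivation d)
fromDerivation (rule₁ {G} inter d)         = inter {G = G} (fromDerivation d)
fromDerivation (rule₁ {G} (D eq) d)        = D {G = G} eq (fromDerivation d)
fromDerivation (rule₁ {G} (T□ eq) d)       = T□ {G = G} eq (fromDerivation d)
fromDerivation (rule₁ {G} (T◇ eq) d)       = T◇ {G = G} eq (fromDerivation d)
fromDerivation (rule₂ {G} ∧R d d')         = ∧R {G = G} (fromDerivation d) (fromDerivation d')
fromDerivation (rule₂ {G} ∨L d d')         = ∨L {G = G} (fromDerivation d) (fromDerivation d')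
fromDerivation (rule₂ {G} ⊃L d d')         = ⊃L {G = G} (fromDerivation d) (fromDerivation d')

_∘ᶜ_ : Ctx → Ctx → Ctx
hole       ∘ᶜ H = H
impC Γ Δ G ∘ᶜ H = impC Γ Δ (G ∘ᶜ H)
boxC Γ Δ G ∘ᶜ H = boxC Γ Δ (G ∘ᶜ H)

plug-∘ᶜ : ∀ G H S → plug (G ∘ᶜ H) S ≡ plug G (plug H S)
plug-∘ᶜ hole         H S = refl
plug-∘ᶜ (impC Γ Δ G) H S = cong (λ T → Γ ⇒ (Δ ++ (imp T ∷ []))) (plug-∘ᶜ G H S)
plug-∘ᶜ (boxC Γ Δ G) H S = cong (λ T → Γ ⇒ (Δ ++ (box T ∷ []))) (plug-∘ᶜ G H S)

module _ {e : Ext} where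

  Derivation-∘ᶜ⁺ : ∀ G H {S} → Derivation e (plug G (plug H S)) → Derivation e (plug (G ∘ᶜ H) S)
  Derivation-∘ᶜ⁺ G H {S} = subst (Derivation e) (sym (plug-∘ᶜ G H S))

  Derivation-∘ᶜ⁻ : ∀ G H {S} → Derivation e (plug (G ∘ᶜ H) S) → Derivation e (plug G (plug H S))
  Derivation-∘ᶜ⁻ G H {S} = subst (Derivation e) (plug-∘ᶜ G H S)

  Derivation-plug : ∀ H {S} → Derivation e S → Derivation e (plug H S)
  Derivation-plug H (axiom {G} r) = Derivation-∘ᶜ⁻ H G (axiom {G = H ∘ᶜ G} r)
  Derivation-plug H (rule₁ {G} r d) =
    Derivation-∘ᶜ⁻ H G (rule₁ {G = H ∘ᶜ G} r (Derivation-∘ᶜ⁺ H G (Derivation-plug H d)))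
  Derivation-plug H (rule₂ {G} r d d') =
    Derivation-∘ᶜ⁻ H G (rule₂ {G = H ∘ᶜ G} r (Derivation-∘ᶜ⁺ H G (Derivation-plug H d))
                                             (Derivation-∘ᶜ⁺ H G (Derivation-plug H d')))

  Derivation-inBox : ∀ {S} → Derivation e S → Derivation e ([] ⇒ (box S ∷ []))
  Derivation-inBox = Derivation-plug (boxC [] [] hole)

  permute-succ-in : ∀ G {Γ Δ Δ'} → Δ ↭ Δ' → Derivation e (plug G (Γ ⇒ Δ)) → Derivation e (plug G (Γ ⇒ Δ'))
  permute-succ-in G p = rule₁ {G = G} (exch ↭-refl p)

  permute-succ : ∀ {Γ Δ Δ'} → Δ ↭ Δ' → Derivation e (Γ ⇒ Δ) → Derivation e (Γ ⇒ Δ')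
  permute-succ = permute-succ-in hole

  swap-succ : ∀ {Γ x y Δ} → Derivation e (Γ ⇒ (x ∷ y ∷ Δ)) → Derivation e (Γ ⇒ (y ∷ x ∷ Δ))
  swap-succ = permute-succ (swap _ _ ↭-refl)

succedent : Seq → List Item
succedent (_ ⇒ Δ) = Δ

Entails : Ext → Seq → Seq → Set
Entails e X N = ∀ H → Derivation e (plug H X) → Derivation e (plug H N)

module _ {e : Ext} where

  Entails-exch : ∀ {Γ Γ' Δ Δ'} → Γ ↭ Γ' → Δ ↭ Δ' → Entails e (Γ ⇒ Δ) (Γ' ⇒ Δ')
  Entails-exch p q H = rule₁ {G = H} (exch p q)

  Entails-trans : ∀ {X Y Z} → Entails e X Y → Entails e Y Z → Entails e X Z
  Entails-trans f g H = g H ∘ f H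

  Entails-plug : ∀ K {X N} → Entails e X N → Entails e (plug K X) (plug K N)
  Entails-plug K f H d = Derivation-∘ᶜ⁻ H K (f (H ∘ᶜ K) (Derivation-∘ᶜ⁺ H K d))

_++ˢ_ : Seq → List Item → Seq
(Γ ⇒ Δ) ++ˢ E = Γ ⇒ (Δ ++ E)

Axiom-++ˢ : ∀ {e C} E → Axiom e C → Axiom e (C ++ˢ E)
Axiom-++ˢ E ax⊥  = ax⊥
Axiom-++ˢ E ax⊤  = ax⊤
Axiom-++ˢ E axAt = axAt

Rule₁-++ˢ : ∀ {e P C} E → Rule₁ e P C → Rule₁ e (P ++ˢ E) (C ++ˢ E)
Rule₁-++ˢ E (exch p q) = exch p (++⁺ʳ E q)
Rule₁-++ˢ E ∧L         = ∧L
Rule₁-++ˢ E ∨R         = ∨R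
Rule₁-++ˢ E ⊃R         = ⊃R
Rule₁-++ˢ E □L         = □L
Rule₁-++ˢ E □R         = □R
Rule₁-++ˢ E ◇L         = ◇L
Rule₁-++ˢ E ◇R         = ◇R
Rule₁-++ˢ E trans      = trans
Rule₁-++ˢ E inter      = inter
Rule₁-++ˢ E (D eq)     = D eq
Rule₁-++ˢ E (T□ eq)    = T□ eq
Rule₁-++ˢ E (T◇ eq)    = T◇ eq

Rule₂-++ˢ : ∀ {e P Q C} E → Rule₂ e P Q C → Rule₂ e (P ++ˢ E) (Q ++ˢ E) (C ++ˢ E)
Rule₂-++ˢ E ∧R = ∧R
Rule₂-++ˢ E ∨L = ∨L
Rule₂-++ˢ E ⊃L = ⊃L

module _ {e : Ext} where

  private
    outward : ∀ {Γ x} Δ E → Derivation e (Γ ⇒ ((Δ ++ E) ++ x ∷ [])) → Derivation e (Γ ⇒ ((Δ ++ x ∷ []) ++ E))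
    outward {x = x} Δ E = permute-succ (↭-sym (middleToEnd Δ (x ∷ []) E))

    inward : ∀ {Γ x} Δ E → Derivation e (Γ ⇒ ((Δ ++ x ∷ []) ++ E)) → Derivation e (Γ ⇒ ((Δ ++ E) ++ x ∷ []))
    inward {x = x} Δ E = permute-succ (middleToEnd Δ (x ∷ []) E)

  weaken-succ : ∀ E {S} → Derivation e S → Derivation e (S ++ˢ E)
  weaken-succ E (axiom {hole} r)            = axiom {G = hole} (Axiom-++ˢ E r)
  weaken-succ E (axiom {impC Γ Δ G} r)      = outward Δ E (axiom {G = impC Γ (Δ ++ E) G} r)
  weaken-succ E (axiom {boxC Γ Δ G} r)      = outward Δ E (axiom {G = boxC Γ (Δ ++ E) G} r)
  weaken-succ E (rule₁ {hole} r d)          = rule₁ {G = hole} (Rule₁-++ˢ E r) (weaken-succ E d)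
  weaken-succ E (rule₁ {impC Γ Δ G} r d)    =
    outward Δ E (rule₁ {G = impC Γ (Δ ++ E) G} r (inward Δ E (weaken-succ E d)))
  weaken-succ E (rule₁ {boxC Γ Δ G} r d)    =
    outward Δ E (rule₁ {G = boxC Γ (Δ ++ E) G} r (inward Δ E (weaken-succ E d)))
  weaken-succ E (rule₂ {hole} r d d')       =
    rule₂ {G = hole} (Rule₂-++ˢ E r) (weaken-succ E d) (weaken-succ E d')
  weaken-succ E (rule₂ {impC Γ Δ G} r d d') =
    outward Δ E (rule₂ {G = impC Γ (Δ ++ E) G} r (inward Δ E (weaken-succ E d)) (inward Δ E (weaken-succ E d')))
  weaken-succ E (rule₂ {boxC Γ Δ G} r d d') =
    outward Δ E (rule₂ {G = boxC Γ (Δ ++ E) G} r (inward Δ E (weaken-succ E d)) (inward Δ E (weaken-succ E d')))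

module Itemwise {A B : Set} (f : A → List B) (h : List A → List B)
                (h-[] : h [] ≡ []) (h-∷ : ∀ x xs → h (x ∷ xs) ≡ f x ++ h xs) where

  h-++ : ∀ xs ys → h (xs ++ ys) ≡ h xs ++ h ys
  h-++ []       ys rewrite h-[] = refl
  h-++ (x ∷ xs) ys = begin
    h (x ∷ xs ++ ys)       ≡⟨ h-∷ x (xs ++ ys) ⟩
    f x ++ h (xs ++ ys)    ≡⟨ cong (f x ++_) (h-++ xs ys) ⟩
    f x ++ (h xs ++ h ys)  ≡⟨ ++-assoc (f x) (h xs) (h ys) ⟨
    (f x ++ h xs) ++ h ys  ≡⟨ cong (_++ h ys) (h-∷ x xs) ⟨
    h (x ∷ xs) ++ h ys     ∎
    where open ≡-Reasoning

  h-↭ : ∀ {xs ys} → xs ↭ ys → h xs ↭ h ys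
  h-↭ ↭.refl = ↭-refl
  h-↭ (prep {xs} {ys} x p) = begin
    h (x ∷ xs)   ≡⟨ h-∷ x xs ⟩
    f x ++ h xs  ↭⟨ ++⁺ˡ (f x) (h-↭ p) ⟩
    f x ++ h ys  ≡⟨ h-∷ x ys ⟨
    h (x ∷ ys)   ∎
    where open ↭.PermutationReasoning
  h-↭ (swap {xs} {ys} x y p) = begin
    h (x ∷ y ∷ xs)        ≡⟨ h-∷₂ x y xs ⟩
    f x ++ f y ++ h xs    ↭⟨ shifts (f x) (f y) ⟩
    f y ++ f x ++ h xs    ↭⟨ ++⁺ˡ (f y) (++⁺ˡ (f x) (h-↭ p)) ⟩
    f y ++ f x ++ h ys    ≡⟨ h-∷₂ y x ys ⟨
    h (y ∷ x ∷ ys)        ∎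
    where
      open ↭.PermutationReasoning
      h-∷₂ : ∀ x y xs → h (x ∷ y ∷ xs) ≡ f x ++ f y ++ h xs
      h-∷₂ x y xs rewrite h-∷ x (y ∷ xs) | h-∷ y xs = refl
  h-↭ (↭.trans p q) = ↭-trans (h-↭ p) (h-↭ q)

flatItem : Item → List Item
flatItem (fm _)          = []
flatItem (imp _)         = []
flatItem (box (Φ ⇒ Ψ))   = box (Φ ⇒ flat Ψ) ∷ []

flat-∷ : ∀ x xs → flat (x ∷ xs) ≡ flatItem x ++ flat xs
flat-∷ (fm _)        xs = refl
flat-∷ (imp _)       xs = refl
flat-∷ (box (Φ ⇒ Ψ)) xs = refl

open Itemwise flatItem flat refl flat-∷ public using () renaming (h-++ to flat-++; h-↭ to flat-↭)

-- Dissolving modal blocks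

-- MergedInto Γᵒ Δᵒ S S' : S' arises from S, up to exchange and extra formulas
-- Γᵒ ⇒ Δᵒ, by dissolving some modal blocks [Σ ⇒ Π] into the sequent containing
-- them (Σ joins its antecedent, Π its succedent).  MergeSucc Δ Γ⁺ Δ⁺ : the
-- succedent Δ becomes Δ⁺ and releases Γ⁺ into the antecedent.
data MergedInto (Γᵒ : List Fm) (Δᵒ : List Item) : Seq → Seq → Set
data MergeSucc : List Item → List Fm → List Item → Set

Merge : Seq → Seq → Set
Merge = MergedInto [] []

data MergedInto Γᵒ Δᵒ where
  mergedInto : ∀ {Γ Δ Γ⁺ Δ⁺ Γ' Δ'} → MergeSucc Δ Γ⁺ Δ⁺ → Γ' ↭ Γᵒ ++ (Γ ++ Γ⁺) → Δ' ↭ Δᵒ ++ Δ⁺ →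
               MergedInto Γᵒ Δᵒ (Γ ⇒ Δ) (Γ' ⇒ Δ')

data MergeSucc where
  []       : MergeSucc [] [] []
  fm       : ∀ {A Δ Γ⁺ Δ⁺} → MergeSucc Δ Γ⁺ Δ⁺ → MergeSucc (fm A ∷ Δ) Γ⁺ (fm A ∷ Δ⁺)
  imp      : ∀ {S S' Δ Γ⁺ Δ⁺} → Merge S S' → MergeSucc Δ Γ⁺ Δ⁺ → MergeSucc (imp S ∷ Δ) Γ⁺ (imp S' ∷ Δ⁺)
  box      : ∀ {S S' Δ Γ⁺ Δ⁺} → Merge S S' → MergeSucc Δ Γ⁺ Δ⁺ → MergeSucc (box S ∷ Δ) Γ⁺ (box S' ∷ Δ⁺)
  dissolve : ∀ {Σ Π Γ₁ Π⁺ Δ Γ⁺ Δ⁺} → MergeSucc Π Γ₁ Π⁺ → MergeSucc Δ Γ⁺ Δ⁺ →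
             MergeSucc (box (Σ ⇒ Π) ∷ Δ) ((Σ ++ Γ₁) ++ Γ⁺) (Π⁺ ++ Δ⁺)

MergeSucc-refl : ∀ Δ → MergeSucc Δ [] Δ
Merge-refl : ∀ S → Merge S S
MergeSucc-refl []          = []
MergeSucc-refl (fm A ∷ Δ)  = fm (MergeSucc-refl Δ)
MergeSucc-refl (imp S ∷ Δ) = imp (Merge-refl S) (MergeSucc-refl Δ)
MergeSucc-refl (box S ∷ Δ) = box (Merge-refl S) (MergeSucc-refl Δ)
Merge-refl (Γ ⇒ Δ) = mergedInto (MergeSucc-refl Δ) (↭-reflexive (sym (++-identityʳ Γ))) ↭-refl

MergeSucc-++⁺ : ∀ {xs ys Γ₁ Δ₁ Γ₂ Δ₂} → MergeSucc xs Γ₁ Δ₁ → MergeSucc ys Γ₂ Δ₂ →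
                MergeSucc (xs ++ ys) (Γ₁ ++ Γ₂) (Δ₁ ++ Δ₂)
MergeSucc-++⁺ []          m = m
MergeSucc-++⁺ (fm mx)     m = fm (MergeSucc-++⁺ mx m)
MergeSucc-++⁺ (imp n mx)  m = imp n (MergeSucc-++⁺ mx m)
MergeSucc-++⁺ (box n mx)  m = box n (MergeSucc-++⁺ mx m)
MergeSucc-++⁺ {Γ₂ = Γ₂} {Δ₂ = Δ₂} (dissolve {Σ} {Π} {Γ₁} {Π⁺} {Δ} {Γ⁺} {Δ⁺} mΠ mx) m =
  subst₂ (MergeSucc _) (sym (++-assoc (Σ ++ Γ₁) Γ⁺ Γ₂)) (sym (++-assoc Π⁺ Δ⁺ Δ₂))
    (dissolve mΠ (MergeSucc-++⁺ mx m))

record MergeSucc-Split (xs ys : List Item) (Γ⁺ : List Fm) (Δ⁺ : List Item) : Set where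
  constructor split
  field
    {Γ₁ Γ₂} : List Fm
    {Δ₁ Δ₂} : List Item
    left    : MergeSucc xs Γ₁ Δ₁
    right   : MergeSucc ys Γ₂ Δ₂
    Γ⁺≡     : Γ⁺ ≡ Γ₁ ++ Γ₂
    Δ⁺≡     : Δ⁺ ≡ Δ₁ ++ Δ₂

MergeSucc-++⁻ : ∀ xs {ys Γ⁺ Δ⁺} → MergeSucc (xs ++ ys) Γ⁺ Δ⁺ → MergeSucc-Split xs ys Γ⁺ Δ⁺
MergeSucc-++⁻ [] m = split [] m refl refl
MergeSucc-++⁻ (fm A ∷ xs) (fm m) with MergeSucc-++⁻ xs m
... | split mx my refl refl = split (fm mx) my refl refl
MergeSucc-++⁻ (imp S ∷ xs) (imp n m) with MergeSucc-++⁻ xs m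
... | split mx my refl refl = split (imp n mx) my refl refl
MergeSucc-++⁻ (box S ∷ xs) (box n m) with MergeSucc-++⁻ xs m
... | split mx my refl refl = split (box n mx) my refl refl
MergeSucc-++⁻ (box (Σ ⇒ Π) ∷ xs) (dissolve {Γ₁ = Γ₁} {Π⁺ = Π⁺} mΠ m) with MergeSucc-++⁻ xs m
... | split {Γ₁ = a} {c} {b} {d} mx my refl refl =
  split (dissolve mΠ mx) my (sym (++-assoc (Σ ++ Γ₁) a c)) (sym (++-assoc Π⁺ b d))

record MergeSucc-Perm (Δ : List Item) (Γ⁺ : List Fm) (Δ⁺ : List Item) : Set where
  constructor permuted
  field
    {Γ₀} : List Fm
    {Δ₀} : List Item
    merged : MergeSucc Δ Γ₀ Δ₀
    Γ₀↭   : Γ₀ ↭ Γ⁺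
    Δ₀↭   : Δ₀ ↭ Δ⁺

MergeSucc-↭ : ∀ {Δ Δ' Γ⁺ Δ⁺} → Δ ↭ Δ' → MergeSucc Δ' Γ⁺ Δ⁺ → MergeSucc-Perm Δ Γ⁺ Δ⁺
MergeSucc-↭ ↭.refl m = permuted m ↭-refl ↭-refl
MergeSucc-↭ (prep x p) m with MergeSucc-++⁻ (x ∷ []) m
... | split {Γ₁ = a} {Δ₁ = b} mx my refl refl with MergeSucc-↭ p my
... | permuted m₀ pΓ pΔ = permuted (MergeSucc-++⁺ mx m₀) (++⁺ˡ a pΓ) (++⁺ˡ b pΔ)
MergeSucc-↭ (swap x y p) m with MergeSucc-++⁻ (y ∷ []) m
... | split {Γ₁ = a₁} {Δ₁ = b₁} my rest refl refl with MergeSucc-++⁻ (x ∷ []) rest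
... | split {Γ₁ = a₂} {Δ₁ = b₂} mx rest' refl refl with MergeSucc-↭ p rest'
... | permuted m₀ pΓ pΔ =
  permuted (MergeSucc-++⁺ mx (MergeSucc-++⁺ my m₀))
    (↭-trans (shifts a₂ a₁) (++⁺ˡ a₁ (++⁺ˡ a₂ pΓ)))
    (↭-trans (shifts b₂ b₁) (++⁺ˡ b₁ (++⁺ˡ b₂ pΔ)))
MergeSucc-↭ (↭.trans p q) m with MergeSucc-↭ q m
... | permuted m₁ p₁ q₁ with MergeSucc-↭ p m₁
... | permuted m₂ p₂ q₂ = permuted m₂ (↭-trans p₂ p₁) (↭-trans q₂ q₁)

MergeSucc-flat : ∀ {Δ Γ⁺ Δ⁺} → MergeSucc Δ Γ⁺ Δ⁺ → MergeSucc (flat Δ) Γ⁺ (flat Δ⁺)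
Merge-flat : ∀ {Φ Ψ Φ' Ψ'} → Merge (Φ ⇒ Ψ) (Φ' ⇒ Ψ') → Merge (Φ ⇒ flat Ψ) (Φ' ⇒ flat Ψ')
MergeSucc-flat [] = []
MergeSucc-flat (fm m) = MergeSucc-flat m
MergeSucc-flat (imp _ m) = MergeSucc-flat m
MergeSucc-flat (box {S = Φ ⇒ Ψ} {S' = Φ' ⇒ Ψ'} n m) = box (Merge-flat n) (MergeSucc-flat m)
MergeSucc-flat (dissolve {Π⁺ = Π⁺} {Δ⁺ = Δ⁺} mΠ m) =
  subst (MergeSucc _ _) (sym (flat-++ Π⁺ Δ⁺)) (dissolve (MergeSucc-flat mΠ) (MergeSucc-flat m))
Merge-flat (mergedInto m p q) = mergedInto (MergeSucc-flat m) p (flat-↭ q)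

data BoxFate (Z : Seq) : List Fm → List Item → Set where
  kept      : ∀ {Z'} → Merge Z Z' → BoxFate Z [] (box Z' ∷ [])
  dissolved : ∀ {Γ₁ Π₁} → MergeSucc (succedent Z) Γ₁ Π₁ → BoxFate Z ((ante Z ++ Γ₁) ++ []) (Π₁ ++ [])

MergeSucc-box⁻ : ∀ Z {Γ⁺ Δ⁺} → MergeSucc (box Z ∷ []) Γ⁺ Δ⁺ → BoxFate Z Γ⁺ Δ⁺
MergeSucc-box⁻ Z       (box n [])      = kept n
MergeSucc-box⁻ (Σ ⇒ Π) (dissolve m []) = dissolved m

MergeSucc-dissolve : ∀ Z {Γ₁ Π₁} → MergeSucc (succedent Z) Γ₁ Π₁ →
                     MergeSucc (box Z ∷ []) ((ante Z ++ Γ₁) ++ []) (Π₁ ++ [])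
MergeSucc-dissolve (Σ ⇒ Π) m = dissolve m []

data ImpFate (Z : Seq) : List Fm → List Item → Set where
  kept : ∀ {Z'} → Merge Z Z' → ImpFate Z [] (imp Z' ∷ [])

MergeSucc-imp⁻ : ∀ {Z Γ⁺ Δ⁺} → MergeSucc (imp Z ∷ []) Γ⁺ Δ⁺ → ImpFate Z Γ⁺ Δ⁺
MergeSucc-imp⁻ (imp n []) = kept n

mergedInto′ : ∀ Z {Γᵒ Δᵒ Γ⁺ Δ⁺ Γ' Δ'} → MergeSucc (succedent Z) Γ⁺ Δ⁺ →
              Γ' ↭ Γᵒ ++ (ante Z ++ Γ⁺) → Δ' ↭ Δᵒ ++ Δ⁺ → MergedInto Γᵒ Δᵒ Z (Γ' ⇒ Δ')
mergedInto′ (_ ⇒ _) = mergedInto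

-- A hole filled with Γ ⇒ Δ, whose succedent merges into Δ⁺ releasing Γ⁺, that
-- ends up in a node whose remaining content is Γʳ ⇒ Δʳ.
mergedHole : List Fm → List Fm → List Item → List Fm → List Item → Seq
mergedHole Γ Γ⁺ Δ⁺ Γʳ Δʳ = (Γ ++ (Γ⁺ ++ Γʳ)) ⇒ (Δ⁺ ++ Δʳ)

-- How a merge of plug G (Γ ⇒ Δ) into N acts on the hole of G: the hole lands at
-- ctx inside N, and the same merge applies to any other filling of the hole.
-- Γᵒ ⇒ Δᵒ collects the material of the blocks around the hole that were dissolved.
record HoleImage (e : Ext) (G : Ctx) (Γ : List Fm) (Δ : List Item) (Γᵒ : List Fm) (Δᵒ : List Item) (N : Seq) : Set where
  constructor holeImage
  field
    ctx      : Ctx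
    Γʳ Γ⁺    : List Fm
    Δʳ Δ⁺    : List Item
    merged   : MergeSucc Δ Γ⁺ Δ⁺
    rebuild  : ∀ {Γʸ Δʸ Γʸ⁺ Δʸ⁺} → MergeSucc Δʸ Γʸ⁺ Δʸ⁺ →
               MergedInto Γᵒ Δᵒ (plug G (Γʸ ⇒ Δʸ)) (plug ctx (mergedHole Γʸ Γʸ⁺ Δʸ⁺ Γʳ Δʳ))
    transfer : Entails e (plug ctx (mergedHole Γ Γ⁺ Δ⁺ Γʳ Δʳ)) N

HoleImage-of : ∀ {e} G {Γ Δ Γᵒ Δᵒ N} → MergedInto Γᵒ Δᵒ (plug G (Γ ⇒ Δ)) N → HoleImage e G Γ Δ Γᵒ Δᵒ N
HoleImage-of hole {Γ} {Γᵒ = Γᵒ} {Δᵒ} (mergedInto {Γ⁺ = Γ⁺} {Δ⁺} m pA pL) =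
  holeImage hole Γᵒ Γ⁺ Δᵒ Δ⁺ m
    (λ {Γʸ} {_} {Γʸ⁺} {Δʸ⁺} mʸ → mergedInto mʸ (rotate Γʸ Γʸ⁺ Γᵒ) (++-comm Δʸ⁺ Δᵒ))
    (Entails-exch (↭-trans (rotate Γ Γ⁺ Γᵒ) (↭-sym pA)) (↭-trans (++-comm Δ⁺ Δᵒ) (↭-sym pL)))
HoleImage-of (impC Σ Π G) {Δᵒ = Δᵒ} {A ⇒ L} (mergedInto m pA pL) with MergeSucc-++⁻ Π m
... | split {Δ₁ = b} mx my refl refl with MergeSucc-imp⁻ my
... | kept n with HoleImage-of G n
... | holeImage ctx Γʳ Γ⁺ Δʳ Δ⁺ merged rebuild transfer =
  holeImage (impC A (Δᵒ ++ b) ctx) Γʳ Γ⁺ Δʳ Δ⁺ merged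
    (λ mʸ → mergedInto (MergeSucc-++⁺ mx (imp (rebuild mʸ) [])) pA (↭-reflexive (++-assoc Δᵒ b _)))
    (Entails-trans (Entails-plug (impC A (Δᵒ ++ b) hole) transfer)
                   (Entails-exch ↭-refl (↭-sym (↭-trans pL (↭-reflexive (sym (++-assoc Δᵒ b _)))))))
HoleImage-of (boxC Σ Π G) {Γ} {Δ} {Γᵒ} {Δᵒ} {A ⇒ L} (mergedInto m pA pL) with MergeSucc-++⁻ Π m
... | split {Γ₁ = a} {Δ₁ = b} mx my refl refl with MergeSucc-box⁻ (plug G (Γ ⇒ Δ)) my
... | kept n with HoleImage-of G n
... | holeImage ctx Γʳ Γ⁺ Δʳ Δ⁺ merged rebuild transfer =
  holeImage (boxC A (Δᵒ ++ b) ctx) Γʳ Γ⁺ Δʳ Δ⁺ merged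
    (λ mʸ → mergedInto (MergeSucc-++⁺ mx (box (rebuild mʸ) [])) pA (↭-reflexive (++-assoc Δᵒ b _)))
    (Entails-trans (Entails-plug (boxC A (Δᵒ ++ b) hole) transfer)
                   (Entails-exch ↭-refl (↭-sym (↭-trans pL (↭-reflexive (sym (++-assoc Δᵒ b _)))))))
HoleImage-of (boxC Σ Π G) {Γ} {Δ} {Γᵒ} {Δᵒ} {A ⇒ L} (mergedInto m pA pL)
  | split {Γ₁ = a} {Δ₁ = b} mx my refl refl | dissolved {Γ₃} {Π₃} m₃
  with HoleImage-of G {Γᵒ = Γᵒ ++ (Σ ++ a)} {Δᵒ ++ b}
         (mergedInto′ (plug G (Γ ⇒ Δ)) m₃ (↭-trans pA (↭-reflexive (regroup Γᵒ Σ a _)))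
                        (↭-trans pL (↭-reflexive (regroup Δᵒ [] b Π₃))))
... | holeImage ctx Γʳ Γ⁺ Δʳ Δ⁺ merged rebuild transfer =
  holeImage ctx Γʳ Γ⁺ Δʳ Δ⁺ merged (λ mʸ → enclose (rebuild mʸ)) transfer
  where
    enclose : ∀ {Z N} → MergedInto (Γᵒ ++ (Σ ++ a)) (Δᵒ ++ b) Z N →
              MergedInto Γᵒ Δᵒ (Σ ⇒ (Π ++ box Z ∷ [])) N
    enclose {Z} (mergedInto {Γ⁺ = Γ₁} {Π₁} mz pA' pL') =
      mergedInto (MergeSucc-++⁺ mx (MergeSucc-dissolve Z mz))
        (↭-trans pA' (↭-reflexive (sym (regroup Γᵒ Σ a _))))
        (↭-trans pL' (↭-reflexive (sym (regroup Δᵒ [] b Π₁))))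

module _ {e : Ext} where

  private
    park : ∀ G {Γ i} x L Δ → Derivation e (plug G (Γ ⇒ (i ∷ x ∷ L ++ Δ))) →
           Derivation e (plug G (Γ ⇒ (i ∷ L ++ x ∷ Δ)))
    park G x L Δ = permute-succ-in G (prep _ (↭-sym (shift x L Δ)))

    unpark : ∀ G {Γ i} x L Δ → Derivation e (plug G (Γ ⇒ (i ∷ L ++ x ∷ Δ))) →
             Derivation e (plug G (Γ ⇒ (i ∷ x ∷ L ++ Δ)))
    unpark G x L Δ = permute-succ-in G (prep _ (shift x L Δ))

  inter* : ∀ G {Γ Σ} Π L Δ →
           Derivation e (plug G (Γ ⇒ (imp (Σ ⇒ (Π ++ flat L)) ∷ (L ++ Δ)))) →
           Derivation e (plug G (Γ ⇒ (imp (Σ ⇒ Π) ∷ (L ++ Δ))))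
  inter* G {Γ} {Σ} Π [] Δ =
    subst (λ Π' → Derivation e (plug G (Γ ⇒ (imp (Σ ⇒ Π') ∷ Δ)))) (++-identityʳ Π)
  inter* G Π (fm A ∷ L) Δ d =
    unpark G (fm A) L Δ (inter* G Π L (fm A ∷ Δ) (park G (fm A) L Δ d))
  inter* G Π (imp S ∷ L) Δ d =
    unpark G (imp S) L Δ (inter* G Π L (imp S ∷ Δ) (park G (imp S) L Δ d))
  inter* G {Γ} {Σ} Π (box (Φ ⇒ Ψ) ∷ L) Δ d =
    rule₁ {G = G} inter (unpark G B L Δ (inter* G (Π ++ box (Φ ⇒ flat Ψ) ∷ []) L (B ∷ Δ) (park G B L Δ d′)))
    where
      B : Item
      B = box (Φ ⇒ Ψ)
      d′ : Derivation e (plug G (Γ ⇒ (imp (Σ ⇒ ((Π ++ box (Φ ⇒ flat Ψ) ∷ []) ++ flat L)) ∷ (B ∷ (L ++ Δ)))))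
      d′ = subst (λ Π' → Derivation e (plug G (Γ ⇒ (imp (Σ ⇒ Π') ∷ (B ∷ (L ++ Δ))))))
                 (sym (++-assoc Π _ (flat L))) d

record MergedPremise (e : Ext) (ΓP : List Fm) (ΔP : List Item) (ΓC Γ⁺ : List Fm) (Δ⁺ : List Item) : Set where
  constructor mergedPremise
  field
    {Γₚ⁺}  : List Fm
    {Δₚ⁺}  : List Item
    merged : MergeSucc ΔP Γₚ⁺ Δₚ⁺
    step   : ∀ Γʳ Δʳ → Entails e (mergedHole ΓP Γₚ⁺ Δₚ⁺ Γʳ Δʳ) (mergedHole ΓC Γ⁺ Δ⁺ Γʳ Δʳ)

record MergedPremises (e : Ext) (ΓP : List Fm) (ΔP : List Item) (ΓQ : List Fm) (ΔQ : List Item)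
                      (ΓC Γ⁺ : List Fm) (Δ⁺ : List Item) : Set where
  constructor mergedPremises
  field
    {Γ₁⁺ Γ₂⁺} : List Fm
    {Δ₁⁺ Δ₂⁺} : List Item
    merged₁   : MergeSucc ΔP Γ₁⁺ Δ₁⁺
    merged₂   : MergeSucc ΔQ Γ₂⁺ Δ₂⁺
    step      : ∀ Γʳ Δʳ H → Derivation e (plug H (mergedHole ΓP Γ₁⁺ Δ₁⁺ Γʳ Δʳ)) →
                Derivation e (plug H (mergedHole ΓQ Γ₂⁺ Δ₂⁺ Γʳ Δʳ)) →
                Derivation e (plug H (mergedHole ΓC Γ⁺ Δ⁺ Γʳ Δʳ))

module _ {e : Ext} where

  Axiom-merge : ∀ {Γ Δ Γ⁺ Δ⁺} → Axiom e (Γ ⇒ Δ) → MergeSucc Δ Γ⁺ Δ⁺ →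
                ∀ Γʳ Δʳ H → Derivation e (plug H (mergedHole Γ Γ⁺ Δ⁺ Γʳ Δʳ))
  Axiom-merge ax⊥  m      _ _ H = axiom {G = H} ax⊥
  Axiom-merge ax⊤  (fm m) _ _ H = axiom {G = H} ax⊤
  Axiom-merge axAt (fm m) _ _ H = axiom {G = H} axAt

  Rule₂-merge : ∀ {ΓP ΔP ΓQ ΔQ ΓC ΔC Γ⁺ Δ⁺} → Rule₂ e (ΓP ⇒ ΔP) (ΓQ ⇒ ΔQ) (ΓC ⇒ ΔC) →
                MergeSucc ΔC Γ⁺ Δ⁺ → MergedPremises e ΓP ΔP ΓQ ΔQ ΓC Γ⁺ Δ⁺
  Rule₂-merge ∧R (fm m) = mergedPremises (fm m) (fm m) (λ _ _ H → rule₂ {G = H} ∧R)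
  Rule₂-merge ∨L m      = mergedPremises m m (λ _ _ H → rule₂ {G = H} ∨L)
  Rule₂-merge ⊃L m      = mergedPremises (fm m) m (λ _ _ H → rule₂ {G = H} ⊃L)

  rule₁-entails : ∀ {P C} → Rule₁ e P C → Entails e P C
  rule₁-entails r H = rule₁ {G = H} r

  Rule₁-merge : ∀ {ΓP ΔP ΓC ΔC Γ⁺ Δ⁺} → e ≡ LIKT → Rule₁ e (ΓP ⇒ ΔP) (ΓC ⇒ ΔC) →
                MergeSucc ΔC Γ⁺ Δ⁺ → MergedPremise e ΓP ΔP ΓC Γ⁺ Δ⁺
  Rule₁-merge isT (exch p q) m with MergeSucc-↭ q m
  ... | permuted m₀ pΓ pΔ =
    mergedPremise m₀ (λ Γʳ Δʳ → Entails-exch (++⁺ p (++⁺ʳ Γʳ pΓ)) (++⁺ʳ Δʳ pΔ))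
  Rule₁-merge isT ∧L m      = mergedPremise m (λ _ _ → rule₁-entails ∧L)
  Rule₁-merge isT ∨R (fm m) = mergedPremise (fm (fm m)) (λ _ _ → rule₁-entails ∨R)
  Rule₁-merge isT ⊃R (fm m) = mergedPremise (imp (Merge-refl _) m) (λ _ _ → rule₁-entails ⊃R)
  Rule₁-merge isT (□L {A = A}) (box (mergedInto mΠ pΣ pΠ) m) =
    mergedPremise (box (mergedInto mΠ (prep A pΣ) pΠ) m) (λ _ _ → rule₁-entails □L)
  -- The dissolved block's A lands next to □A itself, where T□ provides it.
  Rule₁-merge isT (□L {Γ} {A = A}) (dissolve {Σ} {Γ₁ = Γ₁} {Γ⁺ = Γ⁺} mΠ m) =
    mergedPremise (dissolve {Σ = A ∷ Σ} mΠ m)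
      (λ Γʳ Δʳ → Entails-trans (Entails-exch (prep _ (shift A Γ (((Σ ++ Γ₁) ++ Γ⁺) ++ Γʳ))) ↭-refl)
                               (rule₁-entails (T□ isT)))
  Rule₁-merge isT □R (fm m) = mergedPremise (box (Merge-refl _) m) (λ _ _ → rule₁-entails □R)
  Rule₁-merge isT ◇L m      = mergedPremise (box (Merge-refl _) m) (λ _ _ → rule₁-entails ◇L)
  Rule₁-merge isT ◇R (fm (box (mergedInto mΠ pΣ pΠ) m)) =
    mergedPremise (fm (box (mergedInto (fm mΠ) pΣ (prep _ pΠ)) m)) (λ _ _ → rule₁-entails ◇R)
  Rule₁-merge isT ◇R (fm (dissolve mΠ m)) =
    mergedPremise (fm (dissolve (fm mΠ) m)) (λ _ _ → rule₁-entails (T◇ isT))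
  Rule₁-merge isT (trans {Γ} {Γ'} {Σ = Σ}) (imp (mergedInto {Γ⁺ = Γᵢ⁺} mI pI qI) m) =
    mergedPremise (imp (mergedInto mI (↭-trans (++⁺ˡ Γ' pI) (↭-reflexive (sym (++-assoc Γ' Σ Γᵢ⁺)))) qI) m)
      (λ Γʳ Δʳ → let Y = _ ++ Γʳ ; P = middleToEnd Γ Γ' Y in
        Entails-trans (Entails-exch P ↭-refl)
          (Entails-trans (rule₁-entails (trans {Γ = Γ ++ Y} {Γ' = Γ'})) (Entails-exch (↭-sym P) ↭-refl)))
  Rule₁-merge isT inter (imp (mergedInto {Γ⁺ = Γᵢ⁺} mΠ pΣ pΠ) (box {S' = _ ⇒ _} mB m)) =
    mergedPremise
      (imp (mergedInto (MergeSucc-++⁺ mΠ (box (Merge-flat mB) []))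
                       (↭-trans pΣ (↭-reflexive (cong (_ ++_) (sym (++-identityʳ Γᵢ⁺)))))
                       (++⁺ʳ _ pΠ))
           (box mB m))
      (λ _ _ → rule₁-entails inter)
  -- Dissolving [Λ ⇒ Θ] puts Λ beside the implication block, where trans moves it
  -- in, and Θ beside it, where inter* removes Θ^♭ from it.
  Rule₁-merge isT (inter {Γ} {Σ = Σ} {Λ = Λ})
                (imp {S' = Σ₁ ⇒ Π₁} (mergedInto {Γ⁺ = Γᵢ⁺} {Πᵢ} mΠ pΣ pΠ) (dissolve {Γ₁ = Γ₃} {Θᵢ} {Γ⁺ = Γ⁺} {Δ⁺} mΘ m)) =
    mergedPremise
      (imp (mergedInto (MergeSucc-++⁺ mΠ (dissolve (MergeSucc-flat mΘ) []))
                       (↭-trans (++⁺ˡ (Λ ++ Γ₃) pΣ) (rearrange Λ Γ₃ Σ Γᵢ⁺))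
                       (↭-trans (++⁺ʳ (flat Θᵢ) pΠ) (↭-reflexive (cong (Πᵢ ++_) (sym (++-identityʳ _))))))
           (dissolve mΘ m))
      (λ Γʳ Δʳ → let P = isolate Γ Λ Γ₃ Γ⁺ Γʳ in
        Entails-trans (Entails-exch P ↭-refl)
        (Entails-trans (rule₁-entails (trans {Γ = Γ ++ (Γ⁺ ++ Γʳ)} {Γ' = Λ ++ Γ₃}))
        (Entails-trans (Entails-exch (↭-sym P) (prep _ (↭-reflexive (++-assoc Θᵢ Δ⁺ Δʳ))))
        (Entails-trans (λ H → inter* H Π₁ Θᵢ (Δ⁺ ++ Δʳ))
                       (Entails-exch ↭-refl (prep _ (↭-reflexive (sym (++-assoc Θᵢ Δ⁺ Δʳ)))))))))
    where
      rearrange : ∀ l g s x → (l ++ g) ++ (s ++ x) ↭ s ++ (x ++ ((l ++ g) ++ []))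
      rearrange = solve 4 (λ l g s x → (l ⊕ g) ⊕ (s ⊕ x) ⊜ s ⊕ (x ⊕ ((l ⊕ g) ⊕ id))) ↭-refl
        where open FmSolver
      isolate : ∀ g l g₃ x r → g ++ (((l ++ g₃) ++ x) ++ r) ↭ (g ++ (x ++ r)) ++ (l ++ g₃)
      isolate = solve 5 (λ g l g₃ x r → g ⊕ (((l ⊕ g₃) ⊕ x) ⊕ r) ⊜ (g ⊕ (x ⊕ r)) ⊕ (l ⊕ g₃)) ↭-refl
        where open FmSolver
  Rule₁-merge refl (D ()) _
  Rule₁-merge isT (T□ eq)  m      = mergedPremise m (λ _ _ → rule₁-entails (T□ eq))
  Rule₁-merge isT (T◇ eq)  (fm m) = mergedPremise (fm (fm m)) (λ _ _ → rule₁-entails (T◇ eq))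

  merge-admissible : ∀ {S S'} → e ≡ LIKT → Derivation e S → Merge S S' → Derivation e S'
  merge-admissible isT (axiom {G} {_ ⇒ _} r) n with HoleImage-of G n
  ... | holeImage ctx Γʳ _ Δʳ _ merged _ transfer = transfer hole (Axiom-merge r merged Γʳ Δʳ ctx)
  merge-admissible isT (rule₁ {G} {_ ⇒ _} {_ ⇒ _} r d) n with HoleImage-of G n
  ... | holeImage ctx Γʳ _ Δʳ _ merged rebuild transfer with Rule₁-merge isT r merged
  ... | mergedPremise mₚ step =
    transfer hole (step Γʳ Δʳ ctx (merge-admissible isT d (rebuild mₚ)))
  merge-admissible isT (rule₂ {G} {_ ⇒ _} {_ ⇒ _} {_ ⇒ _} r d d') n with HoleImage-of G n
  ... | holeImage ctx Γʳ _ Δʳ _ merged rebuild transfer with Rule₂-merge r merged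
  ... | mergedPremises m₁ m₂ step =
    transfer hole (step Γʳ Δʳ ctx (merge-admissible isT d (rebuild m₁)) (merge-admissible isT d' (rebuild m₂)))

-- Formula-free blocks

data AnteFree : Seq → Set
data AnteFreeItem : Item → Set

data AnteFree where
  anteFree : ∀ {Γ Δ} → Γ ≡ [] → All AnteFreeItem Δ → AnteFree (Γ ⇒ Δ)

data AnteFreeItem where
  fm  : ∀ {A} → AnteFreeItem (fm A)
  imp : ∀ {S} → AnteFreeItem (imp S)
  box : ∀ {S} → AnteFree S → AnteFreeItem (box S)

data Skeleton : Seq → Set
data SkeletonItem : Item → Set

data Skeleton where
  skeleton : ∀ {Δ} → All SkeletonItem Δ → Skeleton ([] ⇒ Δ)

data SkeletonItem where
  box : ∀ {S} → Skeleton S → SkeletonItem (box S)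

flat-skeleton : ∀ {Θ} → All AnteFreeItem Θ → All SkeletonItem (flat Θ)
flat-skeleton [] = []
flat-skeleton (fm ∷ a) = flat-skeleton a
flat-skeleton (imp ∷ a) = flat-skeleton a
flat-skeleton {box (_ ⇒ _) ∷ _} (box (anteFree refl aΨ) ∷ a) = box (skeleton (flat-skeleton aΨ)) ∷ flat-skeleton a

ProvableItem : Ext → Item → Set
ProvableItem e x = Derivation e ([] ⇒ (x ∷ []))

module _ {e : Ext} (isD : e ≡ LIKD) where

  D-removeSkeleton : ∀ G {Γ Δ F} → Skeleton F →
                     Derivation e (plug G (Γ ⇒ (Δ ++ box F ∷ []))) → Derivation e (plug G (Γ ⇒ Δ))
  D-removeSkeletons : ∀ G {Γ Δ Fs} → All SkeletonItem Fs →
                      Derivation e (plug G (Γ ⇒ (Δ ++ Fs))) → Derivation e (plug G (Γ ⇒ Δ))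
  D-removeSkeleton G {Γ} {Δ} (skeleton {Fs} a) p =
    rule₁ {G = G} (D isD) (permute-succ-in G (↭-sym (∷↭∷ʳ _ Δ))
      (Derivation-∘ᶜ⁻ G (boxC Γ Δ hole)
        (D-removeSkeletons (G ∘ᶜ boxC Γ Δ hole) {[]} {[]} a (Derivation-∘ᶜ⁺ G (boxC Γ Δ hole) p))))
  D-removeSkeletons G {Γ} {Δ} [] = subst (λ Δ' → Derivation e (plug G (Γ ⇒ Δ'))) (++-identityʳ Δ)
  D-removeSkeletons G {Γ} {Δ} (box f ∷ a) p =
    D-removeSkeletons G a (D-removeSkeleton G f (permute-succ-in G (lastToFront Δ) p))
    where
      lastToFront : ∀ {x : Item} {xs} Δ → Δ ++ x ∷ xs ↭ (Δ ++ xs) ++ x ∷ []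
      lastToFront {x} {xs} Δ = ↭-trans (++⁺ˡ Δ (∷↭∷ʳ x xs)) (↭-reflexive (sym (++-assoc Δ xs (x ∷ []))))

Skeleton-dissolve : ∀ {Fs} → All SkeletonItem Fs → MergeSucc Fs [] []
Skeleton-dissolve [] = []
Skeleton-dissolve (box (skeleton a) ∷ as) = dissolve (Skeleton-dissolve a) (Skeleton-dissolve as)

T-removeSkeleton : ∀ {e} → e ≡ LIKT → ∀ {Σ Π F} → Skeleton F →
                   ProvableItem e (imp (Σ ⇒ (Π ++ box F ∷ []))) → ProvableItem e (imp (Σ ⇒ Π))
T-removeSkeleton isT {Σ} {Π} {[] ⇒ Fs} (skeleton a) p =
  merge-admissible isT p (mergedInto (imp dissolveF []) ↭-refl ↭-refl)
  where
    dissolveF : Merge (Σ ⇒ (Π ++ box ([] ⇒ Fs) ∷ [])) (Σ ⇒ Π)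
    dissolveF = mergedInto (MergeSucc-++⁺ (MergeSucc-refl Π) (dissolve (Skeleton-dissolve a) []))
                           (↭-reflexive (sym (++-identityʳ Σ))) (↭-reflexive (sym (++-identityʳ Π)))

removeSkeleton : ∀ {e Σ Π F} → Skeleton F →
                 ProvableItem e (imp (Σ ⇒ (Π ++ box F ∷ []))) → ProvableItem e (imp (Σ ⇒ Π))
removeSkeleton {LIKD} = D-removeSkeleton refl (impC [] [] hole)
removeSkeleton {LIKT} = T-removeSkeleton refl

-- Leaves

leaves : List Item → List Item
leaves []                  = []
leaves (fm A ∷ Δ)          = fm A ∷ leaves Δ
leaves (imp S ∷ Δ)         = imp S ∷ leaves Δ
leaves (box (_ ⇒ Ψ) ∷ Δ)   = leaves Ψ ++ leaves Δ

leavesItem : Item → List Item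
leavesItem (fm A)        = fm A ∷ []
leavesItem (imp S)       = imp S ∷ []
leavesItem (box (_ ⇒ Ψ)) = leaves Ψ

leaves-∷ : ∀ x Δ → leaves (x ∷ Δ) ≡ leavesItem x ++ leaves Δ
leaves-∷ (fm _)        Δ = refl
leaves-∷ (imp _)       Δ = refl
leaves-∷ (box (_ ⇒ _)) Δ = refl

open Itemwise leavesItem leaves refl leaves-∷ public using () renaming (h-++ to leaves-++; h-↭ to leaves-↭)

leavesOf : Seq → List Item
leavesOf S = leaves (succedent S)

contextLeaves : Ctx → List Item
contextLeaves hole         = []
contextLeaves (impC Γ Δ G) = leaves Δ
contextLeaves (boxC Γ Δ G) = leaves Δ ++ contextLeaves G

holeLeaves : Ctx → Seq → List Item
holeLeaves hole         X = leavesOf X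
holeLeaves (impC Γ Δ G) X = imp (plug G X) ∷ []
holeLeaves (boxC Γ Δ G) X = holeLeaves G X

leaves-box : ∀ Z → leaves (box Z ∷ []) ≡ leavesOf Z
leaves-box (_ ⇒ Ψ) = ++-identityʳ (leaves Ψ)

leaves-plug : ∀ G X → leavesOf (plug G X) ≡ contextLeaves G ++ holeLeaves G X
leaves-plug hole X = refl
leaves-plug (impC Γ Δ G) X = leaves-++ Δ _
leaves-plug (boxC Γ Δ G) X = begin
  leaves (Δ ++ box (plug G X) ∷ [])                 ≡⟨ leaves-++ Δ _ ⟩
  leaves Δ ++ leaves (box (plug G X) ∷ [])          ≡⟨ cong (leaves Δ ++_) (leaves-box (plug G X)) ⟩
  leaves Δ ++ leavesOf (plug G X)                   ≡⟨ cong (leaves Δ ++_) (leaves-plug G X) ⟩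
  leaves Δ ++ (contextLeaves G ++ holeLeaves G X)   ≡⟨ ++-assoc (leaves Δ) _ _ ⟨
  (leaves Δ ++ contextLeaves G) ++ holeLeaves G X   ∎
  where open ≡-Reasoning

AnteFreeAtHole : Ctx → Seq → Set
AnteFreeAtHole hole         X = AnteFree X
AnteFreeAtHole (impC Γ Δ G) X = ⊤
AnteFreeAtHole (boxC Γ Δ G) X = AnteFreeAtHole G X

private
  lastBlock : ∀ Δ {S} → All AnteFreeItem (Δ ++ box S ∷ []) → AnteFree S
  lastBlock Δ a with Allₚ.++⁻ʳ Δ a
  ... | box f ∷ [] = f

anteFree-hole : ∀ G X → AnteFree (plug G X) → AnteFreeAtHole G X
anteFree-hole hole         X f = f
anteFree-hole (impC Γ Δ G) X f = tt
anteFree-hole (boxC Γ Δ G) X (anteFree _ a) = anteFree-hole G X (lastBlock Δ a)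

anteFree-refill : ∀ G X Y → AnteFree (plug G X) → AnteFreeAtHole G Y → AnteFree (plug G Y)
anteFree-refill hole         X Y _ f = f
anteFree-refill (impC Γ Δ G) X Y (anteFree eq a) _ = anteFree eq (Allₚ.++⁺ (Allₚ.++⁻ˡ Δ a) (imp ∷ []))
anteFree-refill (boxC Γ Δ G) X Y (anteFree eq a) f =
  anteFree eq (Allₚ.++⁺ (Allₚ.++⁻ˡ Δ a) (box (anteFree-refill G X Y (lastBlock Δ a) f) ∷ []))

◇-intro : ∀ {e A} → ProvableItem e (fm A) → ProvableItem e (fm (◇ A))
◇-intro {LIKD} {A} p =
  rule₁ {G = hole} (D refl) (swap-succ (rule₁ {G = hole} (◇R {Σ = []} {Π = []})
    (swap-succ (weaken-succ (fm (◇ A) ∷ []) (Derivation-inBox p)))))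
◇-intro {LIKT} {A} p = rule₁ {G = hole} (T◇ refl) (swap-succ (weaken-succ (fm (◇ A) ∷ []) p))

module _ {e : Ext} where

  ∨-introˡ : ∀ {A B} → ProvableItem e (fm A) → ProvableItem e (fm (A ∨ B))
  ∨-introˡ {B = B} p = rule₁ {G = hole} ∨R (weaken-succ (fm B ∷ []) p)

  ∨-introʳ : ∀ {A B} → ProvableItem e (fm B) → ProvableItem e (fm (A ∨ B))
  ∨-introʳ {A} p = rule₁ {G = hole} ∨R (swap-succ (weaken-succ (fm A ∷ []) p))

  Axiom-leaf : ∀ {C} → Axiom e C → AnteFree C → Any (ProvableItem e) (leavesOf C)
  Axiom-leaf ax⊥  (anteFree () _)
  Axiom-leaf ax⊤  _ = here (axiom {G = hole} ax⊤)
  Axiom-leaf axAt (anteFree () _)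

  Rule₁-anteFree : ∀ {P C} → Rule₁ e P C → AnteFree C → AnteFree P
  Rule₁-anteFree (exch p q) (anteFree refl a) = anteFree (↭-empty-inv p) (All-resp-↭ (↭-sym q) a)
  Rule₁-anteFree ∧L      (anteFree () _)
  Rule₁-anteFree ∨R      (anteFree eq (_ ∷ a)) = anteFree eq (fm ∷ fm ∷ a)
  Rule₁-anteFree ⊃R      (anteFree eq (_ ∷ a)) = anteFree eq (imp ∷ a)
  Rule₁-anteFree □L      (anteFree () _)
  Rule₁-anteFree □R      (anteFree eq (_ ∷ a)) = anteFree eq (box (anteFree refl (fm ∷ [])) ∷ a)
  Rule₁-anteFree ◇L      (anteFree () _)
  Rule₁-anteFree ◇R      (anteFree eq (f ∷ box (anteFree eq' b) ∷ a)) = anteFree eq (f ∷ box (anteFree eq' (fm ∷ b)) ∷ a)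
  Rule₁-anteFree trans   (anteFree eq (_ ∷ a)) = anteFree eq (imp ∷ a)
  Rule₁-anteFree inter   (anteFree eq (_ ∷ a)) = anteFree eq (imp ∷ a)
  Rule₁-anteFree (D _)   (anteFree eq a) = anteFree eq (box (anteFree refl []) ∷ a)
  Rule₁-anteFree (T□ _)  (anteFree () _)
  Rule₁-anteFree (T◇ _)  (anteFree eq (_ ∷ a)) = anteFree eq (fm ∷ fm ∷ a)

  Rule₁-leaf : ∀ {P C} → Rule₁ e P C → AnteFree C →
               Any (ProvableItem e) (leavesOf P) → Any (ProvableItem e) (leavesOf C)
  Rule₁-leaf (exch p q) _ x = Any-resp-↭ (leaves-↭ q) x
  Rule₁-leaf ∨R _ (here p)                = here (∨-introˡ p)
  Rule₁-leaf ∨R _ (there (here p))        = here (∨-introʳ p)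
  Rule₁-leaf ∨R _ (there (there x))       = there x
  Rule₁-leaf ⊃R _ (here p)                = here (rule₁ {G = hole} ⊃R p)
  Rule₁-leaf ⊃R _ (there x)               = there x
  Rule₁-leaf □R _ (here p)                = here (rule₁ {G = hole} □R (Derivation-inBox p))
  Rule₁-leaf □R _ (there x)               = there x
  Rule₁-leaf ◇R _ (here p)                = here p
  Rule₁-leaf ◇R _ (there (here p))        = here (◇-intro p)
  Rule₁-leaf ◇R _ (there (there x))       = there x
  Rule₁-leaf (trans {Γ' = []}) _ (here p) = here p
  Rule₁-leaf (trans {Γ} {_ ∷ _}) (anteFree eq _) (here p) with () ← ++-conicalʳ Γ _ eq
  Rule₁-leaf trans _ (there x)            = there x
  -- The block [⇒ Θ^♭] that inter adds is a skeleton, so it can be dropped again.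
  Rule₁-leaf inter (anteFree _ (_ ∷ box (anteFree refl aΘ) ∷ _)) (here p) =
    here (removeSkeleton (skeleton (flat-skeleton aΘ)) p)
  Rule₁-leaf inter _ (there x)            = there x
  Rule₁-leaf (D _) _ x                    = x
  Rule₁-leaf (T◇ _) _ (here p)            = here p
  Rule₁-leaf (T◇ _) _ (there (here p))    = here (◇-intro p)
  Rule₁-leaf (T◇ _) _ (there (there x))   = there x
  Rule₁-leaf ∧L     (anteFree () _) _
  Rule₁-leaf □L     (anteFree () _) _
  Rule₁-leaf ◇L     (anteFree () _) _
  Rule₁-leaf (T□ _) (anteFree () _) _

  Rule₂-anteFree : ∀ {P Q C} → Rule₂ e P Q C → AnteFree C → AnteFree P × AnteFree Q
  Rule₂-anteFree ∧R (anteFree eq (_ ∷ a)) = anteFree eq (fm ∷ a) , anteFree eq (fm ∷ a)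
  Rule₂-anteFree ∨L (anteFree () _)
  Rule₂-anteFree ⊃L (anteFree () _)

  Rule₂-leaf : ∀ {P Q C} → Rule₂ e P Q C → AnteFree C → Any (ProvableItem e) (leavesOf P) →
               Any (ProvableItem e) (leavesOf Q) → Any (ProvableItem e) (leavesOf C)
  Rule₂-leaf ∧R _ (here p)  (here q)  = here (rule₂ {G = hole} ∧R p q)
  Rule₂-leaf ∧R _ (there x) _         = there x
  Rule₂-leaf ∧R _ (here _)  (there y) = there y
  Rule₂-leaf ∨L (anteFree () _) _ _
  Rule₂-leaf ⊃L (anteFree () _) _ _

  Axiom-holeLeaf : ∀ G {C} → Axiom e C → AnteFreeAtHole G C → Any (ProvableItem e) (holeLeaves G C)
  Axiom-holeLeaf hole         r f = Axiom-leaf r f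
  Axiom-holeLeaf (impC _ _ G) r _ = here (axiom {G = impC [] [] G} r)
  Axiom-holeLeaf (boxC _ _ G) r f = Axiom-holeLeaf G r f

  Rule₁-anteFreeAtHole : ∀ G {P C} → Rule₁ e P C → AnteFreeAtHole G C → AnteFreeAtHole G P
  Rule₁-anteFreeAtHole hole         r f = Rule₁-anteFree r f
  Rule₁-anteFreeAtHole (impC _ _ G) r _ = tt
  Rule₁-anteFreeAtHole (boxC _ _ G) r f = Rule₁-anteFreeAtHole G r f

  Rule₁-holeLeaf : ∀ G {P C} → Rule₁ e P C → AnteFreeAtHole G C →
                   Any (ProvableItem e) (holeLeaves G P) → Any (ProvableItem e) (holeLeaves G C)
  Rule₁-holeLeaf hole         r f x        = Rule₁-leaf r f x
  Rule₁-holeLeaf (impC _ _ G) r _ (here p) = here (rule₁ {G = impC [] [] G} r p)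
  Rule₁-holeLeaf (boxC _ _ G) r f x        = Rule₁-holeLeaf G r f x

  Rule₂-anteFreeAtHole : ∀ G {P Q C} → Rule₂ e P Q C → AnteFreeAtHole G C → AnteFreeAtHole G P × AnteFreeAtHole G Q
  Rule₂-anteFreeAtHole hole         r f = Rule₂-anteFree r f
  Rule₂-anteFreeAtHole (impC _ _ G) r _ = tt , tt
  Rule₂-anteFreeAtHole (boxC _ _ G) r f = Rule₂-anteFreeAtHole G r f

  Rule₂-holeLeaf : ∀ G {P Q C} → Rule₂ e P Q C → AnteFreeAtHole G C →
                   Any (ProvableItem e) (holeLeaves G P) → Any (ProvableItem e) (holeLeaves G Q) →
                   Any (ProvableItem e) (holeLeaves G C)
  Rule₂-holeLeaf hole         r f x        y        = Rule₂-leaf r f x y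
  Rule₂-holeLeaf (impC _ _ G) r _ (here p) (here q) = here (rule₂ {G = impC [] [] G} r p q)
  Rule₂-holeLeaf (boxC _ _ G) r f x        y        = Rule₂-holeLeaf G r f x y

  private
    leaves-plug⁻ : ∀ G X → Any (ProvableItem e) (leavesOf (plug G X)) →
                   Any (ProvableItem e) (contextLeaves G) ⊎ Any (ProvableItem e) (holeLeaves G X)
    leaves-plug⁻ G X x = Anyₚ.++⁻ (contextLeaves G) (subst (Any _) (leaves-plug G X) x)

    leaves-plug⁺ˡ : ∀ G X → Any (ProvableItem e) (contextLeaves G) → Any (ProvableItem e) (leavesOf (plug G X))
    leaves-plug⁺ˡ G X x = subst (Any _) (sym (leaves-plug G X)) (Anyₚ.++⁺ˡ x)

    leaves-plug⁺ʳ : ∀ G X → Any (ProvableItem e) (holeLeaves G X) → Any (ProvableItem e) (leavesOf (plug G X))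
    leaves-plug⁺ʳ G X x = subst (Any _) (sym (leaves-plug G X)) (Anyₚ.++⁺ʳ (contextLeaves G) x)

  some-leaf-provable : ∀ {S} → Derivation e S → AnteFree S → Any (ProvableItem e) (leavesOf S)
  some-leaf-provable (axiom {G} {C} r) f = leaves-plug⁺ʳ G C (Axiom-holeLeaf G r (anteFree-hole G C f))
  some-leaf-provable (rule₁ {G} {P} {C} r d) f
    with leaves-plug⁻ G P (some-leaf-provable d (anteFree-refill G C P f (Rule₁-anteFreeAtHole G r (anteFree-hole G C f))))
  ... | inj₁ x = leaves-plug⁺ˡ G C x
  ... | inj₂ x = leaves-plug⁺ʳ G C (Rule₁-holeLeaf G r (anteFree-hole G C f) x)
  some-leaf-provable (rule₂ {G} {P} {Q} {C} r d d') f
    with Rule₂-anteFreeAtHole G r (anteFree-hole G C f)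
  ... | fP , fQ
    with leaves-plug⁻ G P (some-leaf-provable d (anteFree-refill G C P f fP))
       | leaves-plug⁻ G Q (some-leaf-provable d' (anteFree-refill G C Q f fQ))
  ... | inj₁ x | _      = leaves-plug⁺ˡ G C x
  ... | inj₂ _ | inj₁ y = leaves-plug⁺ˡ G C y
  ... | inj₂ x | inj₂ y = leaves-plug⁺ʳ G C (Rule₂-holeLeaf G r (anteFree-hole G C f) x y)

  provable-from-leaf : ∀ Θ → All AnteFreeItem Θ → Any (ProvableItem e) (leaves Θ) → Derivation e ([] ⇒ Θ)
  provable-from-leaf (fm A ∷ Θ) _ (here p) = weaken-succ Θ p
  provable-from-leaf (fm A ∷ Θ) (_ ∷ a) (there x) =
    permute-succ (↭-sym (∷↭∷ʳ _ Θ)) (weaken-succ (fm A ∷ []) (provable-from-leaf Θ a x))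
  provable-from-leaf (imp S ∷ Θ) _ (here p) = weaken-succ Θ p
  provable-from-leaf (imp S ∷ Θ) (_ ∷ a) (there x) =
    permute-succ (↭-sym (∷↭∷ʳ _ Θ)) (weaken-succ (imp S ∷ []) (provable-from-leaf Θ a x))
  provable-from-leaf (box (_ ⇒ Ψ) ∷ Θ) (box (anteFree refl aΨ) ∷ a) x with Anyₚ.++⁻ (leaves Ψ) x
  ... | inj₁ y = weaken-succ Θ (Derivation-inBox (provable-from-leaf Ψ aΨ y))
  ... | inj₂ y = permute-succ (↭-sym (∷↭∷ʳ _ Θ)) (weaken-succ (box ([] ⇒ Ψ) ∷ []) (provable-from-leaf Θ a y))

∈[·]-there : ∀ {T Γ x Θ} → T ∈[·] (Γ ⇒ Θ) → T ∈[·] (Γ ⇒ (x ∷ Θ))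
∈[·]-there [ direct m ] = [ direct (there m) ]
∈[·]-there (p ∷ q)      = p ∷ ∈[·]-there q

anteFree-∈[·] : ∀ Γ Θ → (∀ T → T ∈[·] (Γ ⇒ Θ) → ante T ≡ []) → All AnteFreeItem Θ
anteFree-∈[·] Γ [] h = []
anteFree-∈[·] Γ (fm A ∷ Θ) h = fm ∷ anteFree-∈[·] Γ Θ (λ T p → h T (∈[·]-there p))
anteFree-∈[·] Γ (imp S ∷ Θ) h = imp ∷ anteFree-∈[·] Γ Θ (λ T p → h T (∈[·]-there p))
anteFree-∈[·] Γ (box (Φ ⇒ Ψ) ∷ Θ) h =
  box (anteFree (h _ [ direct (here refl) ]) (anteFree-∈[·] Φ Ψ (λ T p → h T (p ∷ʳ direct (here refl)))))
  ∷ anteFree-∈[·] Γ Θ (λ T p → h T (∈[·]-there p))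

BoxedAnteFree : List Item → Set
BoxedAnteFree Θ = (T : Seq) → T ∈[·] ([] ⇒ Θ) → ante T ≡ []

leaves-map-fm : ∀ As → leaves (map fm As) ≡ map fm As
leaves-map-fm []       = refl
leaves-map-fm (A ∷ As) = cong (fm A ∷_) (leaves-map-fm As)

leaves-map-imp : ∀ Gs → leaves (map imp Gs) ≡ map imp Gs
leaves-map-imp []       = refl
leaves-map-imp (G ∷ Gs) = cong (imp G ∷_) (leaves-map-imp Gs)

block : List Item → Item
block Θ = box ([] ⇒ Θ)

rootAnteFree : ∀ As Gs Θs → All BoxedAnteFree Θs → AnteFree ([] ⇒ (map fm As ++ map imp Gs ++ map block Θs))
rootAnteFree As Gs Θs hs = anteFree refl
  (Allₚ.++⁺ (Allₚ.map⁺ {xs = As} (All.tabulate λ _ → fm))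
  (Allₚ.++⁺ (Allₚ.map⁺ {xs = Gs} (All.tabulate λ _ → imp))
            (Allₚ.map⁺ (All.map (λ h → box (anteFree refl (anteFree-∈[·] [] _ h))) hs))))

module _ {e : Ext} where

  leaves-++⁻ : ∀ xs ys → Any (ProvableItem e) (leaves (xs ++ ys)) →
               Any (ProvableItem e) (leaves xs) ⊎ Any (ProvableItem e) (leaves ys)
  leaves-++⁻ xs ys x = Anyₚ.++⁻ (leaves xs) (subst (Any _) (leaves-++ xs ys) x)

  provable-block : ∀ Θs → All BoxedAnteFree Θs → Any (ProvableItem e) (leaves (map block Θs)) →
                   Any (λ Θ → Prov e ([] ⇒ (block Θ ∷ []))) Θs
  provable-block (Θ ∷ Θs) (h ∷ hs) x with leaves-++⁻ (block Θ ∷ []) (map block Θs) x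
  ... | inj₁ y = here (fromDerivation (Derivation-inBox (provable-from-leaf Θ (anteFree-∈[·] [] Θ h) y′)))
    where y′ : Any (ProvableItem e) (leaves Θ)
          y′ = subst (Any _) (++-identityʳ (leaves Θ)) y
  ... | inj₂ y = there (provable-block Θs hs y)

lemma7 : (e : Ext) (As : List Fm) (Gs : List Seq) (Θs : List (List Item)) →
         All (λ Θ → (T : Seq) → T ∈[·] ([] ⇒ Θ) → ante T ≡ []) Θs →
         Prov e ([] ⇒ (map fm As ++ map imp Gs ++ map (λ Θ → box ([] ⇒ Θ)) Θs)) →
         Any (λ A → Prov e ([] ⇒ (fm A ∷ []))) As
           ⊎ Any (λ G → Prov e ([] ⇒ (imp G ∷ []))) Gs
           ⊎ Any (λ Θ → Prov e ([] ⇒ (box ([] ⇒ Θ) ∷ []))) Θs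
lemma7 e As Gs Θs hs d with leaves-++⁻ (map fm As) (map imp Gs ++ map block Θs) (some-leaf-provable (toDerivation d) (rootAnteFree As Gs Θs hs))
... | inj₁ x = inj₁ (Any.map fromDerivation (Anyₚ.map⁻ (subst (Any _) (leaves-map-fm As) x)))
... | inj₂ y with leaves-++⁻ (map imp Gs) (map block Θs) y
...   | inj₁ x = inj₂ (inj₁ (Any.map fromDerivation (Anyₚ.map⁻ (subst (Any _) (leaves-map-imp Gs) x))))
...   | inj₂ x = inj₂ (inj₂ (provable-block Θs hs x))
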